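{- Let $\mathscr{C}$ be a finitary many-sorted variety and $F\colon\mathscr{C}\to\mathscr{C}$ an endofunctor preserving sifted colimits. Let $D_Y$ be a filtered diagram of ffg objects $Y_i$ ($i\in I$), with colimit cocone $y_i\colon Y_i\to Y$ and connecting morphisms $y_{ij}$. Let $(A,[a,h],\ddagger)$ be an ffg-Elgot algebra for $F(-)+Y$. Put $h_i=h\cdot y_i$, and for every ffg-equation $e\colon X\to FX+Y_i+A$ put $e^{\dagger,i}=\big((FX+y_i+A)\cdot e\big)^\ddagger$. Then $(A,[a,h_i],(-)^{\dagger,i})$ ($i\in I$) is a compatible family of ffg-Elgot algebras.
   Context: Let $S$ be a set of sorts, $T$ a finitary monad on $\mathbf{Set}^S$, and $\mathscr{C}$ the category of Eilenberg–Moore algebras for $T$, with coproducts $+$ and injections $\mathrm{inl},\mathrm{inr}$. An object is ffg if it is isomorphic to $TX_0$ for a finite $S$-sorted set $X_0$. The definitions below are stated for an endofunctor $G$ of $\mathscr{C}$ preserving sifted colimits, applied to $G=F(-)+Y$ and $G=F(-)+Y_i$. Algebra structures for $F(-)+Y'$ have the form $[a,k]\colon FA+Y'\to A$, and ffg-equations have the form $X\to FX+Y'+A$. Equations and solutions. Put $\mathrm{can}=[G\mathrm{inl},G\mathrm{inr}]$. An ffg-equation is a morphism $e\colon X\to GX+A$ with $X$ ffg. For $k\colon A\to B$ put $k\bullet e=(GX+k)\cdot e$. For $e\colon X\to GX+Y'$ and $f\colon Y'\to GY'+Z$ put $e\boxdot f=(\mathrm{can}+Z)\cdot(GX+f)\cdot[e,\mathrm{inr}]$.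 A solution of $e$ in a $G$-algebra $(A,\alpha)$ is a morphism $s\colon X\to A$ with $s=[\alpha,\mathrm{id}_A]\cdot(Gs+A)\cdot e$. ffg-Elgot algebras. An ffg-Elgot algebra for $G$ is a triple $(A,\alpha,\dagger)$ with $\dagger$ assigning solutions to all ffg-equations, subject to two axioms. (Weak Functoriality) For ffg $X,X',Z$, morphisms $e\colon X\to GX+Z$, $f\colon X'\to GX'+Z$ and $m\colon X\to X'$ with $f\cdot m=(Gm+Z)\cdot e$, and $k\colon Z\to A$, one has $(k\bullet f)^\dagger\cdot m=(k\bullet e)^\dagger$. (Compositionality) For ffg $X,Y'$, $e\colon X\to GX+Y'$ and $f\colon Y'\to GY'+A$, one has $(f^\dagger\bullet e)^\dagger=(e\boxdot f)^\dagger\cdot\mathrm{inl}$. Compatible families. A compatible family of ffg-Elgot algebras is a family $(A,[a,h_i],(-)^{\dagger,i})$ ($i\in I$) of ffg-Elgot algebras for $F(-)+Y_i$, with the same $A$ and $a$, such that for every connecting morphism $y_{ij}$ and every ffg-equation $e\colon X\to FX+Y_i+A$ one has $((FX+y_{ij}+A)\cdot e)^{\dagger,j}=e^{\dagger,i}$. -}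

module Defs where

open import Level using (Level; _⊔_; 0ℓ) renaming (suc to lsuc)
open import Data.Nat using (ℕ)
open import Data.Fin using (Fin)
open import Data.Product using (Σ; Σ-syntax; _×_; _,_; proj₁; proj₂)
open import Function.Bundles using (_↔_)
open import Relation.Binary.PropositionalEquality using (_≡_; refl; sym; trans; cong)
open import Relation.Binary.Structures using (IsEquivalence)
open import Relation.Binary.Construct.Closure.Equivalence using (EqClosure)

record Category (o ℓ e : Level) : Set (lsuc (o ⊔ ℓ ⊔ e)) where
  infixr 9 _∘_
  infix 4 _≈_
  field
    Obj : Set o
    Hom : Obj → Obj → Set ℓ
    _≈_ : ∀ {A B} → Hom A B → Hom A B → Set e
    id : ∀ {A} → Hom A A
    _∘_ : ∀ {A B C} → Hom B C → Hom A B → Hom A C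
    ≈-equiv : ∀ {A B} → IsEquivalence (_≈_ {A} {B})
    ∘-resp-≈ : ∀ {A B C} {f f' : Hom B C} {g g' : Hom A B} →
               f ≈ f' → g ≈ g' → f ∘ g ≈ f' ∘ g'
    identityˡ : ∀ {A B} {f : Hom A B} → id ∘ f ≈ f
    identityʳ : ∀ {A B} {f : Hom A B} → f ∘ id ≈ f
    assoc : ∀ {A B C D} {f : Hom A B} {g : Hom B C} {h : Hom C D} →
            (h ∘ g) ∘ f ≈ h ∘ (g ∘ f)

  module Eq {A B} = IsEquivalence (≈-equiv {A} {B})

SmallCat : Set₁
SmallCat = Category 0ℓ 0ℓ 0ℓ

module _ {o ℓ e o' ℓ' e'} (C : Category o ℓ e) (D : Category o' ℓ' e') where
  private
    module C = Category C
    module D = Category D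

  record Functor : Set (o ⊔ ℓ ⊔ e ⊔ o' ⊔ ℓ' ⊔ e') where
    field
      F₀ : C.Obj → D.Obj
      F₁ : ∀ {A B} → C.Hom A B → D.Hom (F₀ A) (F₀ B)
      identity : ∀ {A} → F₁ (C.id {A}) D.≈ D.id
      homomorphism : ∀ {A B X} {f : C.Hom A B} {g : C.Hom B X} →
                     F₁ (g C.∘ f) D.≈ F₁ g D.∘ F₁ f
      F-resp-≈ : ∀ {A B} {f g : C.Hom A B} → f C.≈ g → F₁ f D.≈ F₁ g

_∘F_ : ∀ {o ℓ e o' ℓ' e' o'' ℓ'' e''}
         {B : Category o ℓ e} {C : Category o' ℓ' e'} {D : Category o'' ℓ'' e''} →
       Functor C D → Functor B C → Functor B D
_∘F_ {C = C} {D = D} G F = record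
  { F₀ = λ X → G.F₀ (F.F₀ X)
  ; F₁ = λ f → G.F₁ (F.F₁ f)
  ; identity = D.Eq.trans (G.F-resp-≈ F.identity) G.identity
  ; homomorphism = D.Eq.trans (G.F-resp-≈ F.homomorphism) G.homomorphism
  ; F-resp-≈ = λ p → G.F-resp-≈ (F.F-resp-≈ p)
  }
  where
    module G = Functor G
    module F = Functor F
    module D = Category D

module _ {o ℓ e} {J : SmallCat} {C : Category o ℓ e} (D : Functor J C) where
  private
    module J = Category J
    module D = Functor D
  open Category C

  record Cocone : Set (o ⊔ ℓ ⊔ e) where
    field
      apex : Obj
      ψ : ∀ j → Hom (D.F₀ j) apex
      commute : ∀ {i j} (u : J.Hom i j) → ψ j ∘ D.F₁ u ≈ ψ i

  open Cocone

  IsColimit : Cocone → Set (o ⊔ ℓ ⊔ e)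
  IsColimit K = (K' : Cocone) →
    Σ (Hom (apex K) (apex K')) λ m →
      ((j : J.Obj) → m ∘ ψ K j ≈ ψ K' j) ×
      ((m' : Hom (apex K) (apex K')) → ((j : J.Obj) → m' ∘ ψ K j ≈ ψ K' j) → m' ≈ m)

mapCocone : ∀ {o ℓ e o' ℓ' e'} {J : SmallCat} {C : Category o ℓ e} {D : Category o' ℓ' e'}
            (F : Functor C D) {Dg : Functor J C} → Cocone Dg → Cocone (F ∘F Dg)
mapCocone {D = D} F {Dg} K = record
  { apex = F.F₀ (Cocone.apex K)
  ; ψ = λ j → F.F₁ (Cocone.ψ K j)
  ; commute = λ u → D.Eq.trans (D.Eq.sym F.homomorphism) (F.F-resp-≈ (Cocone.commute K u))
  }
  where
    module F = Functor F
    module D = Category D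

PreservesColimitsOf : ∀ {o ℓ e o' ℓ' e'} {C : Category o ℓ e} {D : Category o' ℓ' e'} →
                      (SmallCat → Set) → Functor C D → Set (lsuc 0ℓ ⊔ o ⊔ ℓ ⊔ e ⊔ o' ⊔ ℓ' ⊔ e')
PreservesColimitsOf {C = C} P F =
  (J : SmallCat) → P J → (Dg : Functor J C) (K : Cocone Dg) →
  IsColimit Dg K → IsColimit (F ∘F Dg) (mapCocone F K)

record IsFiltered (J : SmallCat) : Set where
  open Category J
  field
    inhabited : Obj
    upperBound : (i j : Obj) → Σ Obj λ k → Hom i k × Hom j k
    coequalize : ∀ {i j} (u v : Hom i j) → Σ Obj λ k → Σ (Hom j k) λ w → w ∘ u ≈ w ∘ v

module _ (J : SmallCat) where
  open Category J

  Cospan : Obj → Obj → Set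
  Cospan i j = Σ Obj λ k → Hom i k × Hom j k

  CospanMor : ∀ {i j} → Cospan i j → Cospan i j → Set
  CospanMor (k , f , g) (k' , f' , g') = Σ (Hom k k') λ m → (m ∘ f ≈ f') × (m ∘ g ≈ g')

-- J is sifted iff J is nonempty and the diagonal J → J × J is final,
-- i.e. every comma category (i , j) ↓ Δ is nonempty and connected.
record IsSifted (J : SmallCat) : Set where
  open Category J
  field
    inhabited : Obj
    cospan : (i j : Obj) → Cospan J i j
    connected : ∀ {i j} (c c' : Cospan J i j) → EqClosure (CospanMor J) c c'

SSet : Set → Set₁
SSet S = S → Set

infixr 0 _⇒_
_⇒_ : {S : Set} → SSet S → SSet S → Set
_⇒_ {S} X Y = (s : S) → X s → Y s

infix 4 _≐_
_≐_ : {S : Set} {X Y : SSet S} → (X ⇒ Y) → (X ⇒ Y) → Set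
_≐_ {S} {X} f g = (s : S) (x : X s) → f s x ≡ g s x

idˢ : {S : Set} {X : SSet S} → X ⇒ X
idˢ s x = x

infixr 9 _∘ˢ_
_∘ˢ_ : {S : Set} {X Y Z : SSet S} → (Y ⇒ Z) → (X ⇒ Y) → (X ⇒ Z)
(g ∘ˢ f) s x = g s (f s x)

SetS : (S : Set) → Category (lsuc 0ℓ) 0ℓ 0ℓ
SetS S = record
  { Obj = SSet S
  ; Hom = λ X Y → X ⇒ Y
  ; _≈_ = _≐_
  ; id = idˢ
  ; _∘_ = _∘ˢ_
  ; ≈-equiv = record { refl = λ s x → refl ; sym = λ p s x → sym (p s x)
                    ; trans = λ p q s x → trans (p s x) (q s x) }
  ; ∘-resp-≈ = λ {f = f} {f'} {g} {g'} p q s x → trans (cong (f s) (q s x)) (p s (g' s x))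
  ; identityˡ = λ s x → refl
  ; identityʳ = λ s x → refl
  ; assoc = λ s x → refl
  }

record Monad (S : Set) : Set₁ where
  field
    functor : Functor (SetS S) (SetS S)
  open Functor functor public renaming (F₀ to T; F₁ to map)
  field
    η : ∀ {X} → X ⇒ T X
    μ : ∀ {X} → T (T X) ⇒ T X
    η-natural : ∀ {X Y} (f : X ⇒ Y) → map {X} {Y} f ∘ˢ η {X} ≐ η {Y} ∘ˢ f
    μ-natural : ∀ {X Y} (f : X ⇒ Y) →
                map {X} {Y} f ∘ˢ μ {X} ≐ μ {Y} ∘ˢ map {T X} {T Y} (map {X} {Y} f)
    μ-η : ∀ {X} → μ {X} ∘ˢ η {T X} ≐ idˢ
    μ-mapη : ∀ {X} → μ {X} ∘ˢ map {X} {T X} (η {X}) ≐ idˢ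
    μ-mapμ : ∀ {X} → μ {X} ∘ˢ map {T (T X)} {T X} (μ {X}) ≐ μ {X} ∘ˢ μ {T X}

Finitary : {S : Set} → Monad S → Set₁
Finitary M = PreservesColimitsOf IsFiltered (Monad.functor M)

module _ {S : Set} (M : Monad S) where
  open Monad M

  record EMAlg : Set₁ where
    field
      Carrier : SSet S
      act : T Carrier ⇒ Carrier
      unit : act ∘ˢ η ≐ idˢ
      assoc : act ∘ˢ μ ≐ act ∘ˢ map act

  record EMHom (A B : EMAlg) : Set where
    field
      fun : EMAlg.Carrier A ⇒ EMAlg.Carrier B
      preserves : fun ∘ˢ EMAlg.act A ≐ EMAlg.act B ∘ˢ map fun

  EM : Category (lsuc 0ℓ) 0ℓ 0ℓ
  EM = record
    { Obj = EMAlg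
    ; Hom = EMHom
    ; _≈_ = λ f g → EMHom.fun f ≐ EMHom.fun g
    ; id = λ {A} → record { fun = idˢ ; preserves = λ s x → cong (EMAlg.act A s) (sym (identity s x)) }
    ; _∘_ = λ {A} {B} {C} g f → record
        { fun = EMHom.fun g ∘ˢ EMHom.fun f
        ; preserves = λ s x → trans (cong (EMHom.fun g s) (EMHom.preserves f s x))
                           (trans (EMHom.preserves g s (map (EMHom.fun f) s x))
                                  (cong (EMAlg.act C s) (sym (homomorphism s x)))) }
    ; ≈-equiv = record { refl = λ s x → refl ; sym = λ p s x → sym (p s x)
                       ; trans = λ p q s x → trans (p s x) (q s x) }
    ; ∘-resp-≈ = λ {f = f} {f'} {g} {g'} p q s x →
        trans (cong (EMHom.fun f s) (q s x)) (p s (EMHom.fun g' s x))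
    ; identityˡ = λ s x → refl
    ; identityʳ = λ s x → refl
    ; assoc = λ s x → refl
    }

  Free : SSet S → EMAlg
  Free X₀ = record
    { Carrier = T X₀
    ; act = μ
    ; unit = μ-η
    ; assoc = λ s x → sym (μ-mapμ s x)
    }

  record Iso (A B : EMAlg) : Set where
    open Category EM
    field
      to : Hom A B
      from : Hom B A
      isoˡ : from ∘ to ≈ id
      isoʳ : to ∘ from ≈ id

  FiniteS : SSet S → Set
  FiniteS X₀ = Σ ℕ λ n → (Σ S X₀ ↔ Fin n)

  IsFfg : EMAlg → Set₁
  IsFfg A = Σ (SSet S) λ X₀ → FiniteS X₀ × Iso A (Free X₀)

record BinaryCoproducts {o ℓ e} (C : Category o ℓ e) : Set (o ⊔ ℓ ⊔ e) where
  open Category C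
  infixl 6 _+_
  field
    _+_ : Obj → Obj → Obj
    inl : ∀ {A B} → Hom A (A + B)
    inr : ∀ {A B} → Hom B (A + B)
    [_,_] : ∀ {A B X} → Hom A X → Hom B X → Hom (A + B) X
    inject₁ : ∀ {A B X} {f : Hom A X} {g : Hom B X} → [ f , g ] ∘ inl ≈ f
    inject₂ : ∀ {A B X} {f : Hom A X} {g : Hom B X} → [ f , g ] ∘ inr ≈ g
    unique : ∀ {A B X} {f : Hom A X} {g : Hom B X} {h : Hom (A + B) X} →
             h ∘ inl ≈ f → h ∘ inr ≈ g → h ≈ [ f , g ]

  infixl 6 _+₁_
  _+₁_ : ∀ {A B X W} → Hom A B → Hom X W → Hom (A + X) (B + W)
  f +₁ g = [ inl ∘ f , inr ∘ g ]

module Elgot {S : Set} (M : Monad S) (CP : BinaryCoproducts (EM M))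
             (F : Functor (EM M) (EM M)) where
  open Category (EM M)
  open BinaryCoproducts CP
  open Functor F

  module _ (Y' : Obj) where
    G₀ : Obj → Obj
    G₀ X = F₀ X + Y'

    G₁ : ∀ {X X'} → Hom X X' → Hom (G₀ X) (G₀ X')
    G₁ m = F₁ m +₁ id

    can : ∀ {X Z} → Hom (G₀ X + G₀ Z) (G₀ (X + Z))
    can = [ G₁ inl , G₁ inr ]

    reassoc : ∀ {P Q R} → Hom (P + (Q + R)) ((P + Q) + R)
    reassoc = [ inl ∘ inl , [ inl ∘ inr , inr ] ]

    _•_ : ∀ {X Z B} → Hom Z B → Hom X (G₀ X + Z) → Hom X (G₀ X + B)
    k • e = (id +₁ k) ∘ e

    _⊡_ : ∀ {X W Z} → Hom X (G₀ X + W) → Hom W (G₀ W + Z) → Hom (X + W) (G₀ (X + W) + Z)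
    e ⊡ f = (can +₁ id) ∘ (reassoc ∘ ((id +₁ f) ∘ [ e , inr ]))

    IsSolution : ∀ {X A} → Hom (G₀ A) A → Hom X (G₀ X + A) → Hom X A → Set
    IsSolution α e s = s ≈ [ α , id ] ∘ ((G₁ s +₁ id) ∘ e)

    Dagger : Obj → Set₁
    Dagger A = (X : Obj) → IsFfg M X → Hom X (G₀ X + A) → Hom X A

    record IsFfgElgot (A : Obj) (α : Hom (G₀ A) A) (dagger : Dagger A) : Set₁ where
      field
        -- dagger is a function of the equation (morphism) only
        ffg-irrelevant : ∀ X (p q : IsFfg M X) (e : Hom X (G₀ X + A)) →
                         dagger X p e ≈ dagger X q e
        dagger-cong : ∀ X (p : IsFfg M X) {e e' : Hom X (G₀ X + A)} →
                      e ≈ e' → dagger X p e ≈ dagger X p e'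
        solution : ∀ X (p : IsFfg M X) (e : Hom X (G₀ X + A)) →
                   IsSolution α e (dagger X p e)
        weak-functoriality :
          ∀ X X' Z (pX : IsFfg M X) (pX' : IsFfg M X') (pZ : IsFfg M Z)
            (e : Hom X (G₀ X + Z)) (f : Hom X' (G₀ X' + Z)) (m : Hom X X') →
          f ∘ m ≈ (G₁ m +₁ id) ∘ e →
          (k : Hom Z A) → dagger X' pX' (k • f) ∘ m ≈ dagger X pX (k • e)
        compositionality :
          ∀ X W (pX : IsFfg M X) (pW : IsFfg M W) (pXW : IsFfg M (X + W))
            (e : Hom X (G₀ X + W)) (f : Hom W (G₀ W + A)) →
          dagger X pX (dagger W pW f • e) ≈ dagger (X + W) pXW (e ⊡ f) ∘ inl

  inducedDagger : ∀ {Y Yᵢ A} → Hom Yᵢ Y → Dagger Y A → Dagger Yᵢ A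
  inducedDagger yᵢ ‡ X p e = ‡ X p (((id +₁ yᵢ) +₁ id) ∘ e)

  module _ {J : SmallCat} (D : Functor J (EM M)) where
    private
      module J = Category J
      module D = Functor D

    record IsCompatibleFamily (A : Obj) (a : Hom (F₀ A) A)
             (h : (i : J.Obj) → Hom (D.F₀ i) A)
             (dagger : (i : J.Obj) → Dagger (D.F₀ i) A) : Set₁ where
      field
        elgot : (i : J.Obj) → IsFfgElgot (D.F₀ i) A [ a , h i ] (dagger i)
        compatible : ∀ {i j} (u : J.Hom i j) (X : Obj) (p : IsFfg M X)
                     (e : Hom X (G₀ (D.F₀ i) X + A)) →
                     dagger j X p (((id +₁ D.F₁ u) +₁ id) ∘ e) ≈ dagger i X p e

module Submission where

open import Relation.Binary.Bundles using (Setoid)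
import Relation.Binary.Reasoning.Setoid as SetoidReasoning
open import Defs

-- Relabelling an equation X → (FX + Yᵢ) + Z along yᵢ : Yᵢ → Y commutes with
-- everything the Elgot axioms are built from: with k • (-), with equation
-- morphisms, and with ⊡; and a solution of the relabelled equation in
-- [a , h] is a solution of the original one in [a , h · yᵢ]. Hence each
-- axiom for (-)^{†,i} is the same axiom for ‡ at a relabelled equation.
-- Compatibility is the cocone equation y_j · y_ij = yᵢ.

module CoproductProperties {o ℓ e} (C : Category o ℓ e) (CP : BinaryCoproducts C) where
  open Category C
  open BinaryCoproducts CP

  hom-setoid : Obj → Obj → Setoid ℓ e
  hom-setoid A B = record { Carrier = Hom A B ; _≈_ = _≈_ ; isEquivalence = ≈-equiv }

  module HomReasoning {A B : Obj} = SetoidReasoning (hom-setoid A B)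

  ∘-resp-≈ˡ : ∀ {A B D} {f f' : Hom B D} {g : Hom A B} → f ≈ f' → f ∘ g ≈ f' ∘ g
  ∘-resp-≈ˡ p = ∘-resp-≈ p Eq.refl

  ∘-resp-≈ʳ : ∀ {A B D} {f : Hom B D} {g g' : Hom A B} → g ≈ g' → f ∘ g ≈ f ∘ g'
  ∘-resp-≈ʳ p = ∘-resp-≈ Eq.refl p

  extendʳ : ∀ {A B B' D E} {f : Hom B D} {g : Hom A B} {f' : Hom B' D} {g' : Hom A B'}
              {k : Hom E A} → f ∘ g ≈ f' ∘ g' → f ∘ (g ∘ k) ≈ f' ∘ (g' ∘ k)
  extendʳ p = Eq.trans (Eq.sym assoc) (Eq.trans (∘-resp-≈ˡ p) assoc)

  id-comm : ∀ {A B} {f : Hom A B} → id ∘ f ≈ f ∘ id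
  id-comm = Eq.trans identityˡ (Eq.sym identityʳ)

  []-cong₂ : ∀ {A B X} {f f' : Hom A X} {g g' : Hom B X} →
             f ≈ f' → g ≈ g' → [ f , g ] ≈ [ f' , g' ]
  []-cong₂ p q = unique (Eq.trans inject₁ p) (Eq.trans inject₂ q)

  ∘-distribˡ-[] : ∀ {A B X Z} {f : Hom A X} {g : Hom B X} {h : Hom X Z} →
                  h ∘ [ f , g ] ≈ [ h ∘ f , h ∘ g ]
  ∘-distribˡ-[] = unique (Eq.trans assoc (∘-resp-≈ʳ inject₁))
                         (Eq.trans assoc (∘-resp-≈ʳ inject₂))

  []∘+₁ : ∀ {A B A' B' X} {f : Hom A X} {g : Hom B X} {h : Hom A' A} {k : Hom B' B} →
          [ f , g ] ∘ (h +₁ k) ≈ [ f ∘ h , g ∘ k ]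
  []∘+₁ = Eq.trans ∘-distribˡ-[]
    ([]-cong₂ (Eq.trans (Eq.sym assoc) (∘-resp-≈ˡ inject₁))
              (Eq.trans (Eq.sym assoc) (∘-resp-≈ˡ inject₂)))

  +₁∘+₁ : ∀ {A B A' B' A'' B''} {f : Hom A A''} {g : Hom B B''} {h : Hom A' A} {k : Hom B' B} →
          (f +₁ g) ∘ (h +₁ k) ≈ (f ∘ h) +₁ (g ∘ k)
  +₁∘+₁ = Eq.trans []∘+₁ ([]-cong₂ assoc assoc)

  +₁-cong₂ : ∀ {A B A' B'} {f f' : Hom A A'} {g g' : Hom B B'} →
             f ≈ f' → g ≈ g' → f +₁ g ≈ f' +₁ g'
  +₁-cong₂ p q = []-cong₂ (∘-resp-≈ʳ p) (∘-resp-≈ʳ q)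

  +₁-comm-square : ∀ {A B A₁ B₁ A₂ B₂ A' B'}
                     {f : Hom A₁ A'} {g : Hom A A₁} {f' : Hom A A₂} {g' : Hom A₂ A'}
                     {h : Hom B₁ B'} {k : Hom B B₁} {h' : Hom B B₂} {k' : Hom B₂ B'} →
                   f ∘ g ≈ g' ∘ f' → h ∘ k ≈ k' ∘ h' →
                   (f +₁ h) ∘ (g +₁ k) ≈ (g' +₁ k') ∘ (f' +₁ h')
  +₁-comm-square p q = Eq.trans +₁∘+₁ (Eq.trans (+₁-cong₂ p q) (Eq.sym +₁∘+₁))

  +₁-swap : ∀ {A B A' B'} {f : Hom A A'} {g : Hom B B'} →
            (id +₁ g) ∘ (f +₁ id) ≈ (f +₁ id) ∘ (id +₁ g)
  +₁-swap = +₁-comm-square id-comm (Eq.sym id-comm)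

  reassoc : ∀ {A B D} → Hom (A + (B + D)) ((A + B) + D)
  reassoc = [ inl ∘ inl , [ inl ∘ inr , inr ] ]

  reassoc-natural : ∀ {A B D A' B' D'} {f : Hom A A'} {g : Hom B B'} {h : Hom D D'} →
                    reassoc ∘ (f +₁ (g +₁ h)) ≈ ((f +₁ g) +₁ h) ∘ reassoc
  reassoc-natural {f = f} {g} {h} = begin
    reassoc ∘ (f +₁ (g +₁ h))
      ≈⟨ Eq.trans []∘+₁ ([]-cong₂ Eq.refl []∘+₁) ⟩
    [ (inl ∘ inl) ∘ f , [ (inl ∘ inr) ∘ g , inr ∘ h ] ]
      ≈⟨ []-cong₂ (inl-square inject₁) ([]-cong₂ (inl-square inject₂) inject₂) ⟨
    [ ((f +₁ g) +₁ h) ∘ (inl ∘ inl) , [ ((f +₁ g) +₁ h) ∘ (inl ∘ inr) , ((f +₁ g) +₁ h) ∘ inr ] ]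
      ≈⟨ Eq.trans ∘-distribˡ-[] ([]-cong₂ Eq.refl ∘-distribˡ-[]) ⟨
    ((f +₁ g) +₁ h) ∘ reassoc
      ∎
    where
      open HomReasoning
      inl-square : ∀ {P P'} {u : Hom P (_ + _)} {u' : Hom P' (_ + _)} {v : Hom P P'} →
                   (f +₁ g) ∘ u ≈ u' ∘ v → ((f +₁ g) +₁ h) ∘ (inl ∘ u) ≈ (inl ∘ u') ∘ v
      inl-square {u = u} {u'} {v} p = begin
        ((f +₁ g) +₁ h) ∘ (inl ∘ u) ≈⟨ extendʳ inject₁ ⟩
        inl ∘ ((f +₁ g) ∘ u)        ≈⟨ ∘-resp-≈ʳ p ⟩
        inl ∘ (u' ∘ v)              ≈⟨ assoc ⟨
        (inl ∘ u') ∘ v              ∎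

module Relabelling {o ℓ e} (C : Category o ℓ e) (CP : BinaryCoproducts C) (F : Functor C C) where
  open Category C
  open BinaryCoproducts CP
  open Functor F
  open CoproductProperties C CP

  relabel : ∀ {Y' Y X P Z} → Hom Y' Y → Hom X ((P + Y') + Z) → Hom X ((P + Y) + Z)
  relabel y e = ((id +₁ y) +₁ id) ∘ e

  relabel-cong : ∀ {Y' Y X P Z} (y : Hom Y' Y) {e e' : Hom X ((P + Y') + Z)} →
                 e ≈ e' → relabel y e ≈ relabel y e'
  relabel-cong y = ∘-resp-≈ʳ

  relabel-∘ : ∀ {Y'' Y' Y X P Z} {y : Hom Y'' Y} {y' : Hom Y' Y} {d : Hom Y'' Y'} →
              y' ∘ d ≈ y → (e : Hom X ((P + Y'') + Z)) → relabel y' (relabel d e) ≈ relabel y e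
  relabel-∘ y'∘d≈y e = Eq.trans (Eq.sym assoc)
    (∘-resp-≈ˡ (Eq.trans +₁∘+₁ (+₁-cong₂ (Eq.trans +₁∘+₁ (+₁-cong₂ identityˡ y'∘d≈y)) identityˡ)))

  module _ {Y' Y : Obj} (y : Hom Y' Y) where
    open HomReasoning

    relabel-natural : ∀ {P P' Z Z'} (g : Hom P P') (k : Hom Z Z') →
                      ((g +₁ id) +₁ k) ∘ ((id +₁ y) +₁ id) ≈ ((id +₁ y) +₁ id) ∘ ((g +₁ id) +₁ k)
    relabel-natural g k = +₁-comm-square (Eq.sym +₁-swap) (Eq.sym id-comm)

    relabel-• : ∀ {X P Z B} (k : Hom Z B) (e : Hom X ((P + Y') + Z)) →
                relabel y ((id +₁ k) ∘ e) ≈ (id +₁ k) ∘ relabel y e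
    relabel-• k e = extendʳ (Eq.sym +₁-swap)

    relabel-equation-morphism : ∀ {X X' Z} (e : Hom X ((F₀ X + Y') + Z)) (f : Hom X' ((F₀ X' + Y') + Z))
                                  (m : Hom X X') → f ∘ m ≈ ((F₁ m +₁ id) +₁ id) ∘ e →
                                relabel y f ∘ m ≈ ((F₁ m +₁ id) +₁ id) ∘ relabel y e
    relabel-equation-morphism e f m f∘m≈e = begin
      (((id +₁ y) +₁ id) ∘ f) ∘ m                       ≈⟨ assoc ⟩
      ((id +₁ y) +₁ id) ∘ (f ∘ m)                       ≈⟨ ∘-resp-≈ʳ f∘m≈e ⟩
      ((id +₁ y) +₁ id) ∘ (((F₁ m +₁ id) +₁ id) ∘ e)    ≈⟨ extendʳ (relabel-natural (F₁ m) id) ⟨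
      ((F₁ m +₁ id) +₁ id) ∘ (((id +₁ y) +₁ id) ∘ e)    ∎

    relabel-⊡ : ∀ {X W Z} (e : Hom X ((F₀ X + Y') + W)) (f : Hom W ((F₀ W + Y') + Z)) →
                relabel y (([ F₁ inl +₁ id , F₁ inr +₁ id ] +₁ id) ∘ (reassoc ∘ ((id +₁ f) ∘ [ e , inr ])))
                ≈ ([ F₁ inl +₁ id , F₁ inr +₁ id ] +₁ id) ∘
                    (reassoc ∘ ((id +₁ relabel y f) ∘ [ relabel y e , inr ]))
    relabel-⊡ e f = Eq.sym (begin
      (can +₁ id) ∘ (reassoc ∘ ((id +₁ Φ ∘ f) ∘ [ Φ ∘ e , inr ]))
        ≈⟨ ∘-resp-≈ʳ (∘-resp-≈ʳ (∘-resp-≈ʳ relabel-[])) ⟩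
      (can +₁ id) ∘ (reassoc ∘ ((id +₁ Φ ∘ f) ∘ (Φ ∘ [ e , inr ])))
        ≈⟨ ∘-resp-≈ʳ (∘-resp-≈ʳ (extendʳ (+₁-comm-square id-comm identityʳ))) ⟩
      (can +₁ id) ∘ (reassoc ∘ (((id +₁ y) +₁ Φ) ∘ ((id +₁ f) ∘ [ e , inr ])))
        ≈⟨ ∘-resp-≈ʳ (extendʳ reassoc-natural) ⟩
      (can +₁ id) ∘ ((((id +₁ y) +₁ (id +₁ y)) +₁ id) ∘ (reassoc ∘ ((id +₁ f) ∘ [ e , inr ])))
        ≈⟨ extendʳ (+₁-comm-square relabel-can id-comm) ⟩
      Φ ∘ ((can +₁ id) ∘ (reassoc ∘ ((id +₁ f) ∘ [ e , inr ])))
        ∎)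
      where
        Φ : ∀ {P Q} → Hom ((P + Y') + Q) ((P + Y) + Q)
        Φ = (id +₁ y) +₁ id

        can : ∀ {P Q B} → Hom ((F₀ P + B) + (F₀ Q + B)) (F₀ (P + Q) + B)
        can = [ F₁ inl +₁ id , F₁ inr +₁ id ]

        relabel-[] : [ Φ ∘ e , inr ] ≈ Φ ∘ [ e , inr ]
        relabel-[] = Eq.sym (Eq.trans ∘-distribˡ-[] ([]-cong₂ Eq.refl (Eq.trans inject₂ identityʳ)))

        relabel-can : ∀ {P Q} → can {P} {Q} ∘ ((id +₁ y) +₁ (id +₁ y)) ≈ (id +₁ y) ∘ can
        relabel-can = Eq.trans []∘+₁
          (Eq.trans ([]-cong₂ (Eq.sym +₁-swap) (Eq.sym +₁-swap)) (Eq.sym ∘-distribˡ-[]))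

    relabel-algebra : ∀ {A} (a : Hom (F₀ A) A) (h : Hom Y A) →
                      [ [ a , h ] , id ] ∘ ((id +₁ y) +₁ id) ≈ [ [ a , h ∘ y ] , id ]
    relabel-algebra a h = Eq.trans []∘+₁ ([]-cong₂ (Eq.trans []∘+₁ ([]-cong₂ identityʳ Eq.refl)) identityʳ)

    solution-of-relabel : ∀ {X A} (a : Hom (F₀ A) A) (h : Hom Y A)
                            (e : Hom X ((F₀ X + Y') + A)) (s : Hom X A) →
                          s ≈ [ [ a , h ] , id ] ∘ (((F₁ s +₁ id) +₁ id) ∘ relabel y e) →
                          s ≈ [ [ a , h ∘ y ] , id ] ∘ (((F₁ s +₁ id) +₁ id) ∘ e)
    solution-of-relabel a h e s sol = begin
      s                                                            ≈⟨ sol ⟩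
      [ [ a , h ] , id ] ∘ (((F₁ s +₁ id) +₁ id) ∘ relabel y e)     ≈⟨ ∘-resp-≈ʳ (extendʳ (relabel-natural (F₁ s) id)) ⟩
      [ [ a , h ] , id ] ∘ (((id +₁ y) +₁ id) ∘ (((F₁ s +₁ id) +₁ id) ∘ e)) ≈⟨ assoc ⟨
      ([ [ a , h ] , id ] ∘ ((id +₁ y) +₁ id)) ∘ (((F₁ s +₁ id) +₁ id) ∘ e) ≈⟨ ∘-resp-≈ˡ (relabel-algebra a h) ⟩
      [ [ a , h ∘ y ] , id ] ∘ (((F₁ s +₁ id) +₁ id) ∘ e)          ∎

module InducedDagger {S : Set} (M : Monad S) (CP : BinaryCoproducts (EM M))
                     (F : Functor (EM M) (EM M)) where
  open Category (EM M)
  open BinaryCoproducts CP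
  open Functor F
  open Elgot M CP F
  open Relabelling (EM M) CP F
  open CoproductProperties (EM M) CP using (module HomReasoning)

  inducedDagger-isFfgElgot : ∀ {Y' Y A} (y : Hom Y' Y) (a : Hom (F₀ A) A) (h : Hom Y A)
                               (‡ : Dagger Y A) → IsFfgElgot Y A [ a , h ] ‡ →
                             IsFfgElgot Y' A [ a , h ∘ y ] (inducedDagger y ‡)
  inducedDagger-isFfgElgot {Y'} {Y} {A} y a h ‡ E = record
    { ffg-irrelevant = λ X p q e → E.ffg-irrelevant X p q (relabel y e)
    ; dagger-cong = λ X p {e} {e'} e≈e' → E.dagger-cong X p (relabel-cong y {e} {e'} e≈e')
    ; solution = λ X p e → solution-of-relabel y a h e (‡ X p (relabel y e)) (E.solution X p (relabel y e))
    ; weak-functoriality = weak-functoriality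
    ; compositionality = compositionality
    }
    where
      module E = IsFfgElgot E
      open HomReasoning

      dagger-cong-∘ : ∀ {W} X (p : IsFfg M X) {e e' : Hom X (G₀ Y X + A)} (m : Hom W X) →
                      e ≈ e' → ‡ X p e ∘ m ≈ ‡ X p e' ∘ m
      dagger-cong-∘ X p {e} {e'} m e≈e' =
        ∘-resp-≈ {f = ‡ X p e} {‡ X p e'} {m} {m} (E.dagger-cong X p e≈e') (Eq.refl {x = m})

      weak-functoriality :
        ∀ X X' Z (pX : IsFfg M X) (pX' : IsFfg M X') (pZ : IsFfg M Z)
          (e : Hom X (G₀ Y' X + Z)) (f : Hom X' (G₀ Y' X' + Z)) (m : Hom X X') →
        f ∘ m ≈ (G₁ Y' m +₁ id) ∘ e → (k : Hom Z A) →
        ‡ X' pX' (relabel y (_•_ Y' k f)) ∘ m ≈ ‡ X pX (relabel y (_•_ Y' k e))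
      weak-functoriality X X' Z pX pX' pZ e f m f∘m≈e k = begin
        ‡ X' pX' (relabel y (_•_ Y' k f)) ∘ m ≈⟨ dagger-cong-∘ X' pX' m (relabel-• y k f) ⟩
        ‡ X' pX' (_•_ Y k (relabel y f)) ∘ m
          ≈⟨ E.weak-functoriality X X' Z pX pX' pZ (relabel y e) (relabel y f) m
               (relabel-equation-morphism y e f m f∘m≈e) k ⟩
        ‡ X pX (_•_ Y k (relabel y e))       ≈⟨ E.dagger-cong X pX (relabel-• y k e) ⟨
        ‡ X pX (relabel y (_•_ Y' k e))       ∎

      compositionality :
        ∀ X W (pX : IsFfg M X) (pW : IsFfg M W) (pXW : IsFfg M (X + W))
          (e : Hom X (G₀ Y' X + W)) (f : Hom W (G₀ Y' W + A)) →
        ‡ X pX (relabel y (_•_ Y' (‡ W pW (relabel y f)) e))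
          ≈ ‡ (X + W) pXW (relabel y (_⊡_ Y' e f)) ∘ inl
      compositionality X W pX pW pXW e f = begin
        ‡ X pX (relabel y (_•_ Y' f† e))      ≈⟨ E.dagger-cong X pX (relabel-• y f† e) ⟩
        ‡ X pX (_•_ Y f† (relabel y e))       ≈⟨ E.compositionality X W pX pW pXW (relabel y e) (relabel y f) ⟩
        ‡ (X + W) pXW (_⊡_ Y (relabel y e) (relabel y f)) ∘ inl
          ≈⟨ dagger-cong-∘ (X + W) pXW inl (relabel-⊡ y e f) ⟨
        ‡ (X + W) pXW (relabel y (_⊡_ Y' e f)) ∘ inl ∎
        where
          f† : Hom W A
          f† = ‡ W pW (relabel y f)

mainTheorem15 : (S : Set) (M : Monad S) → Finitary M →
    (CP : BinaryCoproducts (EM M)) →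
    (F : Functor (EM M) (EM M)) → PreservesColimitsOf IsSifted F →
    (J : SmallCat) → IsFiltered J →
    (DY : Functor J (EM M)) →
    ((i : Category.Obj J) → IsFfg M (Functor.F₀ DY i)) →
    (KY : Cocone DY) → IsColimit DY KY →
    (A : Category.Obj (EM M)) →
    (a : Category.Hom (EM M) (Functor.F₀ F A) A) →
    (h : Category.Hom (EM M) (Cocone.apex KY) A) →
    (‡ : Elgot.Dagger M CP F (Cocone.apex KY) A) →
    Elgot.IsFfgElgot M CP F (Cocone.apex KY) A (BinaryCoproducts.[_,_] CP a h) ‡ →
    Elgot.IsCompatibleFamily M CP F DY A a
      (λ i → Category._∘_ (EM M) h (Cocone.ψ KY i))
      (λ i → Elgot.inducedDagger M CP F (Cocone.ψ KY i) ‡)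
mainTheorem15 S M _ CP F _ J _ DY _ KY _ A a h ‡ isElgot = record
  { elgot = λ i → inducedDagger-isFfgElgot (ψ i) a h ‡ isElgot
  ; compatible = λ {i} {j} u X p e → IsFfgElgot.dagger-cong isElgot X p
      (relabel-∘ {y = ψ i} {y' = ψ j} {d = Functor.F₁ DY u} (commute u) e)
  }
  where
    open Cocone KY
    open Elgot M CP F using (IsFfgElgot)
    open Relabelling (EM M) CP F using (relabel-∘)
    open InducedDagger M CP F using (inducedDagger-isFfgElgot)
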